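{- For every $n\geq1$, the map $\mu$ induces a bijection from $\mathcal{F}_{2n}$ onto $\mathcal{S}_n$.
   Context: A Fibonacci meander with central angle $180$ degrees of length $2n$ is a word $w=w_1\cdots w_{2n}$ over $\{L,R\}$ encoding a closed smooth curve in the plane made of $2n$ semicircular arcs (arcs of angle $180^\circ$, all of the same radius): the curve starts at the origin with tangent pointing north, each arc starts at the end of the previous one with the same tangent direction, and arc $w_i$ turns counterclockwise (to the left) if $w_i=L$ and clockwise (to the right) if $w_i=R$. It is required that $w_1=L$, that the curve is closed (ends at the origin), and that the word has no factor $LL$ except inside the maximal initial run of $L$'s (a run of any length of $L$'s is allowed at the beginning). Let $\mathcal{F}_{2n}$ be the set of these meanders. Let $\tau$ map two-letter words to steps: $\tau(RL)=U$, $\tau(LR)=D$, $\tau(RR)=F$, $\tau(LL)=\widetilde F$, and set $\mu(w)=\tau(w_1w_2)\tau(w_3w_4)\cdots\tau(w_{2n-1}w_{2n})$. Here $U=(1,1)$, $D=(1,-1)$, and $F$, $\widetilde F$ are two distinct kinds of flat step $(1,0)$ ($\widetilde F$ is called a wavy flat). A peakless grand Motzkin path of length $n$ is a lattice path from $(0,0)$ to $(n,0)$ with steps $U,D,F$ (allowed to go below the $x$-axis) with no factor $UD$. $\mathcal{S}_n$ is the set of length-$n$ words over $\{U,D,F,\widetilde F\}$ that are either a peakless grand Motzkin path starting with a $D$-step, or of the form $\widetilde F^{\,j}\gamma$ with $j\geq1$ and $\gamma$ a (possibly empty) peakless grand Motzkin path. -}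

module Defs where

open import Data.Bool using (Bool; true; false; not)
open import Data.Nat using (ℕ; suc; _*_; _≤_)
open import Data.Integer using (ℤ; +_; _+_; -_)
open import Data.List using (List; []; _∷_; length; replicate; _++_)
open import Data.Product using (_×_; Σ; ∃; ∃₂; _,_)
open import Data.Sum using (_⊎_)
open import Data.Unit using (⊤)
open import Data.Empty using (⊥)
open import Relation.Binary.PropositionalEquality using (_≡_; _≢_)
open import Data.List.Relation.Unary.All using (All)

-- Letters of a meander word: L = counterclockwise arc, R = clockwise arc.
data Letter : Set where
  L R : Letter

-- Steps: U = (1,1), D = (1,-1), F = flat, Fw = wavy flat (F with tilde).
data Step : Set where
  U D F Fw : Step

-- Geometry of semicircular arcs (radius 1).
-- The tangent at the start/end of every arc is vertical, so every arc
-- endpoint lies on the x-axis; a state is (x-coordinate, heading north?).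
-- An arc heading north turning left ends 2 units to the west (heading
-- south); turning right ends 2 units east.  Heading south it is mirrored.

arcShift : Bool → Letter → ℤ
arcShift true  L = - (+ 2)
arcShift true  R = + 2
arcShift false L = + 2
arcShift false R = - (+ 2)

endState : ℤ × Bool → List Letter → ℤ × Bool
endState s [] = s
endState (x , h) (a ∷ w) = endState (x + arcShift h a , not h) w

-- the curve starting at the origin heading north is closed (returns to
-- the origin, and with the same tangent direction north, hence smooth)
Closed : List Letter → Set
Closed w = endState (+ 0 , true) w ≡ (+ 0 , true)

dropL : List Letter → List Letter
dropL (L ∷ w) = dropL w
dropL w = w

NoLL : List Letter → Set
NoLL (L ∷ L ∷ _) = ⊥
NoLL (_ ∷ w) = NoLL w
NoLL [] = ⊤

IsFibMeander : ℕ → List Letter → Set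
IsFibMeander n w =
  length w ≡ 2 * n × (Σ (List Letter) λ w' → w ≡ L ∷ w') × Closed w × NoLL (dropL w)

τ : Letter → Letter → Step
τ R L = U
τ L R = D
τ R R = F
τ L L = Fw

μ : List Letter → List Step
μ (a ∷ b ∷ w) = τ a b ∷ μ w
μ _ = []

stepHeight : Step → ℤ
stepHeight U = + 1
stepHeight D = - (+ 1)
stepHeight F = + 0
stepHeight Fw = + 0

height : List Step → ℤ
height [] = + 0
height (s ∷ p) = stepHeight s + height p

NoUD : List Step → Set
NoUD (U ∷ D ∷ _) = ⊥
NoUD (_ ∷ p) = NoUD p
NoUD [] = ⊤

IsPGM : List Step → Set
IsPGM p = All (λ s → s ≢ Fw) p × height p ≡ + 0 × NoUD p

IsS : ℕ → List Step → Set
IsS n s = length s ≡ n ×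
  ((Σ (List Step) λ γ → s ≡ D ∷ γ × IsPGM s)
   ⊎ (∃₂ λ (j : ℕ) (γ : List Step) → 1 ≤ j × s ≡ replicate j Fw ++ γ × IsPGM γ))

-- Reading a word two letters at a time, every pair of arcs moves the
-- endpoint by 4·(height of its step) and restores the northward heading,
-- so a word closes iff its step path returns to height 0.  A factor LL
-- lies either inside a pair (a wavy flat) or across two pairs (a peak UD),
-- so no LL after the initial run means: after the leading wavy flats, a
-- peakless Motzkin path.  A word starting with L has first step D or Fw,
-- which gives the two shapes of 𝓢ₙ.
module Submission where

open import Defs
open import Data.Nat using (ℕ; _≤_; zero; suc; z≤n; s≤s) renaming (_*_ to _*ℕ_)
open import Data.Nat.Properties using (*-suc; *-cancelˡ-≡; suc-injective)
open import Data.Integer using (+_; _+_; _*_)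
import Data.Integer.Properties as ℤ
open import Data.List using (List; []; _∷_; length; replicate; _++_)
open import Data.List.Relation.Unary.All using (All; []; _∷_)
open import Data.Product using (_×_; Σ; ∃; ∃₂; _,_; proj₁)
open import Data.Sum using (_⊎_; inj₁; inj₂)
open import Data.Unit using (tt)
open import Data.Bool using (true; false)
open import Data.Empty using (⊥-elim)
open import Relation.Binary.PropositionalEquality
  using (_≡_; _≢_; refl; sym; trans; cong; cong₂; subst)
open Relation.Binary.PropositionalEquality.≡-Reasoning

firstLetter secondLetter : Step → Letter
firstLetter U  = R
firstLetter D  = L
firstLetter F  = R
firstLetter Fw = L
secondLetter U  = L
secondLetter D  = R
secondLetter F  = R
secondLetter Fw = L

μ⁻¹ : List Step → List Letter
μ⁻¹ []      = []
μ⁻¹ (s ∷ p) = firstLetter s ∷ secondLetter s ∷ μ⁻¹ p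

τ-letters : ∀ s → τ (firstLetter s) (secondLetter s) ≡ s
τ-letters U  = refl
τ-letters D  = refl
τ-letters F  = refl
τ-letters Fw = refl

μ⁻¹-τ : ∀ a b p → μ⁻¹ (τ a b ∷ p) ≡ a ∷ b ∷ μ⁻¹ p
μ⁻¹-τ L L p = refl
μ⁻¹-τ L R p = refl
μ⁻¹-τ R L p = refl
μ⁻¹-τ R R p = refl

μ-μ⁻¹ : ∀ p → μ (μ⁻¹ p) ≡ p
μ-μ⁻¹ []      = refl
μ-μ⁻¹ (s ∷ p) = cong₂ _∷_ (τ-letters s) (μ-μ⁻¹ p)

μ⁻¹-μ : ∀ n w → length w ≡ 2 *ℕ n → μ⁻¹ (μ w) ≡ w
μ⁻¹-μ zero [] _ = refl
μ⁻¹-μ (suc n) w len with w | trans len (*-suc 2 n)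
... | a ∷ b ∷ w′ | len′ =
  trans (μ⁻¹-τ a b (μ w′)) (cong (λ v → a ∷ b ∷ v) (μ⁻¹-μ n w′ (suc-injective (suc-injective len′))))

length-μ⁻¹ : ∀ p → length (μ⁻¹ p) ≡ 2 *ℕ length p
length-μ⁻¹ []      = refl
length-μ⁻¹ (s ∷ p) = trans (cong (λ k → suc (suc k)) (length-μ⁻¹ p)) (sym (*-suc 2 (length p)))

arcShift-pair : ∀ s → arcShift true (firstLetter s) + arcShift false (secondLetter s) ≡ + 4 * stepHeight s
arcShift-pair U  = refl
arcShift-pair D  = refl
arcShift-pair F  = refl
arcShift-pair Fw = refl

endState-μ⁻¹ : ∀ x p → endState (x , true) (μ⁻¹ p) ≡ (x + + 4 * height p , true)
endState-μ⁻¹ x []      = cong (_, true) (sym (ℤ.+-identityʳ x))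
endState-μ⁻¹ x (s ∷ p) = trans (endState-μ⁻¹ ((x + a) + b) p) (cong (_, true) shift)
  where
  a = arcShift true (firstLetter s)
  b = arcShift false (secondLetter s)
  h = height p
  shift : ((x + a) + b) + + 4 * h ≡ x + + 4 * (stepHeight s + h)
  shift = begin
    ((x + a) + b) + + 4 * h            ≡⟨ cong (_+ + 4 * h) (ℤ.+-assoc x a b) ⟩
    (x + (a + b)) + + 4 * h            ≡⟨ ℤ.+-assoc x (a + b) _ ⟩
    x + ((a + b) + + 4 * h)            ≡⟨ cong (λ t → x + (t + + 4 * h)) (arcShift-pair s) ⟩
    x + (+ 4 * stepHeight s + + 4 * h) ≡⟨ cong (λ t → x + t) (sym (ℤ.*-distribˡ-+ (+ 4) (stepHeight s) h)) ⟩
    x + + 4 * (stepHeight s + h)       ∎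

closed-μ⁻¹⇒height≡0 : ∀ p → Closed (μ⁻¹ p) → height p ≡ + 0
closed-μ⁻¹⇒height≡0 p closed = ℤ.*-cancelˡ-≡ (+ 4) (height p) (+ 0)
  (trans (sym (ℤ.+-identityˡ _)) (cong proj₁ (trans (sym (endState-μ⁻¹ (+ 0) p)) closed)))

height≡0⇒closed-μ⁻¹ : ∀ p → height p ≡ + 0 → Closed (μ⁻¹ p)
height≡0⇒closed-μ⁻¹ p h rewrite endState-μ⁻¹ (+ 0) p | h = refl

noLL-μ⁻¹⇒peakless : ∀ p → NoLL (μ⁻¹ p) → All (_≢ Fw) p × NoUD p
noLL-μ⁻¹⇒peakless []                 _ = [] , tt
noLL-μ⁻¹⇒peakless (U ∷ [])           _ = (λ ()) ∷ [] , tt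
noLL-μ⁻¹⇒peakless (U ∷ p@(U ∷ _)) noLL with noLL-μ⁻¹⇒peakless p noLL
... | noFw , noUD = (λ ()) ∷ noFw , noUD
noLL-μ⁻¹⇒peakless (U ∷ D ∷ _)        ()
noLL-μ⁻¹⇒peakless (U ∷ p@(F ∷ _)) noLL with noLL-μ⁻¹⇒peakless p noLL
... | noFw , noUD = (λ ()) ∷ noFw , noUD
noLL-μ⁻¹⇒peakless (U ∷ Fw ∷ _)       ()
noLL-μ⁻¹⇒peakless (D ∷ p) noLL with noLL-μ⁻¹⇒peakless p noLL
... | noFw , noUD = (λ ()) ∷ noFw , noUD
noLL-μ⁻¹⇒peakless (F ∷ p) noLL with noLL-μ⁻¹⇒peakless p noLL
... | noFw , noUD = (λ ()) ∷ noFw , noUD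
noLL-μ⁻¹⇒peakless (Fw ∷ _)           ()

peakless⇒noLL-μ⁻¹ : ∀ p → All (_≢ Fw) p → NoUD p → NoLL (μ⁻¹ p)
peakless⇒noLL-μ⁻¹ []                 _              _    = tt
peakless⇒noLL-μ⁻¹ (U ∷ [])           _              _    = tt
peakless⇒noLL-μ⁻¹ (U ∷ p@(U ∷ _))    (_ ∷ noFw)     noUD = peakless⇒noLL-μ⁻¹ p noFw noUD
peakless⇒noLL-μ⁻¹ (U ∷ D ∷ _)        _              ()
peakless⇒noLL-μ⁻¹ (U ∷ p@(F ∷ _))    (_ ∷ noFw)     noUD = peakless⇒noLL-μ⁻¹ p noFw noUD
peakless⇒noLL-μ⁻¹ (U ∷ Fw ∷ _)       (_ ∷ ¬Fw ∷ _)  _    = ⊥-elim (¬Fw refl)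
peakless⇒noLL-μ⁻¹ (D ∷ p)            (_ ∷ noFw)     noUD = peakless⇒noLL-μ⁻¹ p noFw noUD
peakless⇒noLL-μ⁻¹ (F ∷ p)            (_ ∷ noFw)     noUD = peakless⇒noLL-μ⁻¹ p noFw noUD
peakless⇒noLL-μ⁻¹ (Fw ∷ _)           (¬Fw ∷ _)      _    = ⊥-elim (¬Fw refl)

noLL-μ⁻¹⇒pgm : ∀ p → height p ≡ + 0 → NoLL (μ⁻¹ p) → IsPGM p
noLL-μ⁻¹⇒pgm p h noLL with noLL-μ⁻¹⇒peakless p noLL
... | noFw , noUD = noFw , h , noUD

pgm⇒noLL-μ⁻¹ : ∀ p → IsPGM p → NoLL (μ⁻¹ p)
pgm⇒noLL-μ⁻¹ p (noFw , _ , noUD) = peakless⇒noLL-μ⁻¹ p noFw noUD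

noLL⇒noLL-dropL : ∀ w → NoLL w → NoLL (dropL w)
noLL⇒noLL-dropL []          _    = tt
noLL⇒noLL-dropL (R ∷ _)     noLL = noLL
noLL⇒noLL-dropL (L ∷ [])    _    = tt
noLL⇒noLL-dropL (L ∷ R ∷ _) noLL = noLL
noLL⇒noLL-dropL (L ∷ L ∷ _) ()

dropL-μ⁻¹-wavy : ∀ j p → dropL (μ⁻¹ (replicate j Fw ++ p)) ≡ dropL (μ⁻¹ p)
dropL-μ⁻¹-wavy zero    p = refl
dropL-μ⁻¹-wavy (suc j) p = dropL-μ⁻¹-wavy j p

height-wavy : ∀ j p → height (replicate j Fw ++ p) ≡ height p
height-wavy zero    p = refl
height-wavy (suc j) p = trans (ℤ.+-identityˡ _) (height-wavy j p)

ShapeS : List Step → Set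
ShapeS s = (Σ (List Step) λ γ → s ≡ D ∷ γ × IsPGM s)
         ⊎ (∃₂ λ (j : ℕ) (γ : List Step) → 1 ≤ j × s ≡ replicate j Fw ++ γ × IsPGM γ)

wavyPrefix : ∀ p → height p ≡ + 0 → NoLL (dropL (μ⁻¹ p)) →
             ∃₂ λ (j : ℕ) (γ : List Step) → p ≡ replicate j Fw ++ γ × IsPGM γ
wavyPrefix (Fw ∷ p)  h noLL with wavyPrefix p (trans (sym (ℤ.+-identityˡ _)) h) noLL
... | j , γ , refl , pgm = suc j , γ , refl , pgm
wavyPrefix []        h noLL = 0 , [] , refl , [] , h , tt
wavyPrefix p@(U ∷ _) h noLL = 0 , p , refl , noLL-μ⁻¹⇒pgm p h noLL
wavyPrefix p@(D ∷ _) h noLL = 0 , p , refl , noLL-μ⁻¹⇒pgm p h noLL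
wavyPrefix p@(F ∷ _) h noLL = 0 , p , refl , noLL-μ⁻¹⇒pgm p h noLL

meander⇒shapeS : ∀ s → (∃ λ w → μ⁻¹ s ≡ L ∷ w) → height s ≡ + 0 → NoLL (dropL (μ⁻¹ s)) → ShapeS s
meander⇒shapeS (D ∷ γ) _ h noLL = inj₁ (γ , refl , noLL-μ⁻¹⇒pgm (D ∷ γ) h noLL)
meander⇒shapeS (Fw ∷ s) _ h noLL with wavyPrefix s (trans (sym (ℤ.+-identityˡ _)) h) noLL
... | j , γ , refl , pgm = inj₂ (suc j , γ , s≤s z≤n , refl , pgm)
meander⇒shapeS []      (_ , ())
meander⇒shapeS (U ∷ _) (_ , ())
meander⇒shapeS (F ∷ _) (_ , ())

shapeS⇒meander : ∀ s → ShapeS s → (∃ λ w → μ⁻¹ s ≡ L ∷ w) × height s ≡ + 0 × NoLL (dropL (μ⁻¹ s))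
shapeS⇒meander s (inj₁ (_ , refl , pgm@(_ , h , _))) =
  (_ , refl) , h , noLL⇒noLL-dropL (μ⁻¹ s) (pgm⇒noLL-μ⁻¹ s pgm)
shapeS⇒meander s (inj₂ (suc j , γ , _ , refl , pgm@(_ , h , _))) =
  (_ , refl) , trans (height-wavy (suc j) γ) h ,
  subst NoLL (sym (dropL-μ⁻¹-wavy (suc j) γ)) (noLL⇒noLL-dropL (μ⁻¹ γ) (pgm⇒noLL-μ⁻¹ γ pgm))

fibMeander-μ⁻¹⇒S : ∀ n s → IsFibMeander n (μ⁻¹ s) → IsS n s
fibMeander-μ⁻¹⇒S n s (len , startL , closed , noLL) =
  *-cancelˡ-≡ (length s) n 2 (trans (sym (length-μ⁻¹ s)) len) ,
  meander⇒shapeS s startL (closed-μ⁻¹⇒height≡0 s closed) noLL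

S⇒fibMeander-μ⁻¹ : ∀ n s → IsS n s → IsFibMeander n (μ⁻¹ s)
S⇒fibMeander-μ⁻¹ n s (len , shape) with shapeS⇒meander s shape
... | startL , h , noLL =
  trans (length-μ⁻¹ s) (cong (2 *ℕ_) len) , startL , height≡0⇒closed-μ⁻¹ s h , noLL

proposition2 : (n : ℕ) → 1 ≤ n →
    ((w : List Letter) → IsFibMeander n w → IsS n (μ w))
    × ((w w' : List Letter) → IsFibMeander n w → IsFibMeander n w' → μ w ≡ μ w' → w ≡ w')
    × ((s : List Step) → IsS n s → Σ (List Letter) λ w → IsFibMeander n w × μ w ≡ s)
proposition2 n _ = toS , injective , surjective
  where
  μ⁻¹-μ-meander : ∀ w → IsFibMeander n w → μ⁻¹ (μ w) ≡ w
  μ⁻¹-μ-meander w (len , _) = μ⁻¹-μ n w len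

  toS : (w : List Letter) → IsFibMeander n w → IsS n (μ w)
  toS w m = fibMeander-μ⁻¹⇒S n (μ w) (subst (IsFibMeander n) (sym (μ⁻¹-μ-meander w m)) m)

  injective : (w w' : List Letter) → IsFibMeander n w → IsFibMeander n w' → μ w ≡ μ w' → w ≡ w'
  injective w w' m m' eq = begin
    w            ≡⟨ sym (μ⁻¹-μ-meander w m) ⟩
    μ⁻¹ (μ w)    ≡⟨ cong μ⁻¹ eq ⟩
    μ⁻¹ (μ w')   ≡⟨ μ⁻¹-μ-meander w' m' ⟩
    w'           ∎

  surjective : (s : List Step) → IsS n s → Σ (List Letter) λ w → IsFibMeander n w × μ w ≡ s
  surjective s sS = μ⁻¹ s , S⇒fibMeander-μ⁻¹ n s sS , μ-μ⁻¹ s
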